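{- Let $q\ge 0$ be an integer such that $p=4q+3$ is prime, and let $a$ be a positive integer whose residue class modulo $p$ is a quadratic non-residue of $\mathbb{Z}_p$. Then \[dac\big(\overrightarrow{C}_{8q^2+2(a+4)q+a+3}(1,a)\big)\geq 4q+3.\] Moreover, for $a=3$ (when $3$ is a quadratic non-residue of $\mathbb{Z}_{4q+3}$) equality holds: $dac(\overrightarrow{C}_{8q^2+14q+6}(1,3))=4q+3$.
   Context: For an integer $n$ and a set $J\subseteq\{1,\dots,n-1\}$, the circulant digraph $\overrightarrow{C}_n(J)$ has vertex set $\mathbb{Z}_n$ and arc set $\{(i,j): j-i\equiv s \pmod n \text{ for some } s\in J\}$. An acyclic vertex coloring of a digraph $D$ is one with no monochromatic directed cycle. A complete $k$-vertex-coloring of $D$ uses exactly $k$ colors and, for every ordered pair $(i,j)$ of distinct colors, there is an arc $(u,v)$ with $u$ colored $i$ and $v$ colored $j$. The diachromatic number $dac(D)$ is the largest $k$ for which $D$ has a complete acyclic $k$-vertex-coloring. A quadratic non-residue of $\mathbb{Z}_p$ is a nonzero element that is not a square. -}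

module Defs where

open import Data.Nat using (ℕ; zero; suc; _+_; _*_; _≤_; _<_; NonZero)
open import Data.Nat.DivMod using (_%_)
open import Data.Fin using (Fin; toℕ)
import Data.Fin
import Data.Nat.DivMod
open import Data.List using (List; _∷_; [])
open import Data.List.Membership.Propositional using (_∈_)
open import Data.Product using (Σ; ∃; _×_; _,_)
open import Data.Empty using (⊥)
open import Relation.Nullary using (¬_)
open import Relation.Binary.PropositionalEquality using (_≡_; _≢_)
open import Function.Definitions using (Injective; Surjective)

record Digraph : Set₁ where
  field
    size : ℕ
    Arc  : Fin size → Fin size → Set
open Digraph public

Circulant : (n : ℕ) → .{{NonZero n}} → List ℕ → Digraph
Circulant n J = record
  { size = n
  ; Arc  = λ i j → Σ ℕ (λ s → s ∈ J × ((toℕ i + s) % n ≡ toℕ j)) }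

record DirectedCycle (D : Digraph) : Set where
  field
    len      : ℕ
    vert     : Fin (suc len) → Fin (size D)
    distinct : Injective _≡_ _≡_ vert
    step     : ∀ (t : Fin (suc len)) →
               Arc D (vert t) (vert (Data.Fin.fromℕ< (Data.Nat.DivMod.m%n<n (suc (toℕ t)) (suc len))))
open DirectedCycle public

Coloring : Digraph → ℕ → Set
Coloring D k = Fin (size D) → Fin k

Acyclic : (D : Digraph) {k : ℕ} → Coloring D k → Set
Acyclic D c = (C : DirectedCycle D) →
  ¬ (∀ t → c (vert C t) ≡ c (vert C Data.Fin.zero))

Complete : (D : Digraph) {k : ℕ} → Coloring D k → Set
Complete D {k} c =
  Surjective _≡_ _≡_ c ×
  (∀ (i j : Fin k) → i ≢ j →
     Σ (Fin (size D)) λ u → Σ (Fin (size D)) λ v → Arc D u v × c u ≡ i × c v ≡ j)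

HasCompleteAcyclic : Digraph → ℕ → Set
HasCompleteAcyclic D k = Σ (Coloring D k) λ c → Complete D c × Acyclic D c

-- dac(D) ≥ k  (dac is the largest k admitting a complete acyclic k-coloring)
DacGe : Digraph → ℕ → Set
DacGe D k = Σ ℕ λ k' → k ≤ k' × HasCompleteAcyclic D k'

DacEq : Digraph → ℕ → Set
DacEq D k = HasCompleteAcyclic D k × (∀ k' → k < k' → ¬ HasCompleteAcyclic D k')

QNR : (p : ℕ) → .{{NonZero p}} → ℕ → Set
QNR p a = ¬ (a % p ≡ 0) × ¬ (Σ ℕ λ x → (x * x) % p ≡ a % p)

-- Write p = 2h + 1 and L = 2h + a, so that n = hL + 1.  Cut ℤ_n into the h blocks
-- {jL, …, jL + L} (consecutive blocks share an endpoint) and colour the vertex k + jL of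
-- block j by base j + (j+1)² k mod p, where base (j+1) = base j + (j+1)² L makes the shared
-- endpoints agree.  An arc of length s ∈ {1, a} inside a block changes the colour by
-- s (j+1)² ≢ 0, so a monochromatic arc leaves its block and strictly lowers the position
-- inside the block: there is no monochromatic cycle.  As a is a non-residue, the 2h numbers
-- s (j+1)² with s ∈ {1, a} and j < h are distinct and nonzero mod p, hence they are all the
-- nonzero residues, and every difference y − x of colours is realised by an arc inside some
-- block: the colouring is complete.
-- Conversely, in a complete k-colouring of a circulant with two jumps every colour class has
-- at least (k − 1)/2 vertices, since each other colour is entered by an arc leaving the class;
-- for n = 8q² + 14q + 6 and k ≥ 4q + 4 this needs more than n vertices.

module Submission where

open import Defs
open import Data.Nat using (ℕ; zero; suc; _+_; _*_; _∸_; _≤_; _<_; z≤n; s≤s; s≤s⁻¹; z<s; NonZero; >-nonZero)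
open import Data.Nat.Properties
open import Data.Nat.DivMod
open import Data.Nat.Divisibility using (_∣_; divides; ∣⇒≤; ∣1⇒≡1; n∣m⇒m%n≡0; n∣m*n)
open import Data.Nat.Primality using (Prime; euclidsLemma; ¬prime[1])
open import Data.Nat.Tactic.RingSolver using (solve-∀)
open import Data.Fin as Fin using (Fin; toℕ; fromℕ<; punchOut; punchIn; combine; remQuot; inject≤)
open import Data.Fin.Properties as Fin
  using ( any?; punchOut-injective; punchIn-injective; punchInᵢ≢i; injective⇒≤; toℕ-injective; toℕ-fromℕ<; toℕ<n
        ; fromℕ<-cong; combine-injective; combine-remQuot; inject≤-injective )
open import Data.List using (List; []; _∷_; length; lookup; filter; allFin)
open import Data.List.Membership.Propositional using (_∈_)
open import Data.List.Membership.Propositional.Properties using (∈-lookup; ∈-filter⁺; ∈-filter⁻; ∈-allFin)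
open import Data.List.Membership.Setoid.Properties using (index-injective)
open import Data.List.Relation.Unary.Any using (here; there; index)
import Data.List.Relation.Unary.All as All
open import Data.List.Relation.Unary.AllPairs using (_∷_)
open import Data.List.Relation.Unary.Unique.Propositional using (Unique)
open import Data.List.Relation.Unary.Unique.Propositional.Properties using (allFin⁺; filter⁺)
open import Data.Product using (Σ; ∃; ∃₂; _×_; _,_; proj₁; proj₂; uncurry)
open import Data.Sum using (inj₁; inj₂; [_,_]′)
open import Function using (_∘_)
open import Function.Definitions using (Injective; Surjective)
open import Relation.Nullary using (¬_; yes; no; contradiction)
open import Relation.Binary.PropositionalEquality
  using (_≡_; _≢_; refl; sym; trans; cong; cong₂; subst; subst₂; setoid; module ≡-Reasoning)
open import Relation.Binary using (IsEquivalence; Setoid)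
import Relation.Binary.Reasoning.Setoid as ≈-Reasoning
open import Level using (0ℓ)

injective⇒surjective : ∀ {m} {f : Fin m → Fin m} → Injective _≡_ _≡_ f → ∀ y → ∃ λ x → f x ≡ y
injective⇒surjective {suc m} {f} f-injective y with any? (λ x → f x Fin.≟ y)
... | yes hit  = hit
... | no  miss = contradiction (injective⇒≤ g-injective) 1+n≰n
  where
  avoids : ∀ x → y ≢ f x
  avoids x y≡fx = miss (x , sym y≡fx)
  g : Fin (suc m) → Fin m
  g x = punchOut (avoids x)
  g-injective : Injective _≡_ _≡_ g
  g-injective gx≡gx′ = f-injective (punchOut-injective (avoids _) (avoids _) gx≡gx′)

lookup-injective : ∀ {A : Set} {xs : List A} → Unique xs → ∀ {i j} → lookup xs i ≡ lookup xs j → i ≡ j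
lookup-injective (_   ∷ _) {Fin.zero}  {Fin.zero}  _ = refl
lookup-injective (x∉xs ∷ _) {Fin.zero}  {Fin.suc j} e = contradiction e (All.lookup x∉xs (∈-lookup j))
lookup-injective (x∉xs ∷ _) {Fin.suc i} {Fin.zero}  e = contradiction (sym e) (All.lookup x∉xs (∈-lookup i))
lookup-injective (_   ∷ u) {Fin.suc i} {Fin.suc j} e = cong Fin.suc (lookup-injective u e)

acyclic-by-potential : (D : Digraph) {k : ℕ} (c : Coloring D k) (φ : Fin (size D) → ℕ) →
  (∀ u w → Arc D u w → c u ≡ c w → φ w < φ u) → Acyclic D c
acyclic-by-potential D c φ descends C monochromatic = <-irrefl refl (begin-strict
  ψ 0        <⟨ m<m+n (ψ 0) z<s ⟩
  ψ 0 + N    ≡⟨ cong (_+ N) wraps ⟨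
  ψ N + N    ≤⟨ descent N ⟩
  ψ 0        ∎)
  where
  open ≤-Reasoning
  N : ℕ
  N = suc (len C)
  position : ℕ → Fin N
  position i = fromℕ< (m%n<n i N)
  ψ : ℕ → ℕ
  ψ i = φ (vert C (position i))
  next-position : ∀ i → fromℕ< (m%n<n (suc (toℕ (position i))) N) ≡ position (suc i)
  next-position i = fromℕ<-cong _ _ (begin-equality
    suc (toℕ (position i)) % N  ≡⟨ cong (λ r → suc r % N) (toℕ-fromℕ< (m%n<n i N)) ⟩
    (1 + i % N) % N             ≡⟨ %-distribˡ-+ 1 (i % N) N ⟩
    (1 % N + i % N % N) % N     ≡⟨ cong (λ r → (1 % N + r) % N) (m%n%n≡m%n i N) ⟩
    (1 % N + i % N) % N         ≡⟨ %-distribˡ-+ 1 i N ⟨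
    suc i % N                   ∎) _ _
  ψ-decreasing : ∀ i → ψ (suc i) < ψ i
  ψ-decreasing i = subst (λ v → φ (vert C v) < ψ i) (next-position i)
    (descends _ _ (step C (position i)) (trans (monochromatic _) (sym (monochromatic _))))
  descent : ∀ i → ψ i + i ≤ ψ 0
  descent zero    = ≤-reflexive (+-identityʳ (ψ 0))
  descent (suc i) = begin
    ψ (suc i) + suc i  ≡⟨ +-suc (ψ (suc i)) i ⟩
    suc (ψ (suc i)) + i ≤⟨ +-monoˡ-≤ i (ψ-decreasing i) ⟩
    ψ i + i            ≤⟨ descent i ⟩
    ψ 0                ∎
  wraps : ψ N ≡ ψ 0
  wraps = cong (φ ∘ vert C) (fromℕ<-cong (N % N) 0 (n%n≡0 N) (m%n<n N N) z<s)

module Modular (p : ℕ) .{{_ : NonZero p}} where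

  infix 4 _≈_
  record _≈_ (x y : ℕ) : Set where
    constructor ≈-by-%
    field %≡% : x % p ≡ y % p
  open _≈_ public

  ≈-isEquivalence : IsEquivalence _≈_
  ≈-isEquivalence = record
    { refl  = ≈-by-% refl
    ; sym   = λ x≈y → ≈-by-% (sym (%≡% x≈y))
    ; trans = λ x≈y y≈z → ≈-by-% (trans (%≡% x≈y) (%≡% y≈z))
    }

  ≈-setoid : Setoid 0ℓ 0ℓ
  ≈-setoid = record { isEquivalence = ≈-isEquivalence }

  open IsEquivalence ≈-isEquivalence public
    using () renaming (refl to ≈-refl; sym to ≈-sym; trans to ≈-trans)

  ≡⇒≈ : ∀ {x y} → x ≡ y → x ≈ y
  ≡⇒≈ refl = ≈-refl

  ≈-+ : ∀ {x y u v} → x ≈ y → u ≈ v → x + u ≈ y + v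
  ≈-+ {x} {y} {u} {v} (≈-by-% x≈y) (≈-by-% u≈v) = ≈-by-% (begin
    (x + u) % p          ≡⟨ %-distribˡ-+ x u p ⟩
    (x % p + u % p) % p  ≡⟨ cong₂ (λ m k → (m + k) % p) x≈y u≈v ⟩
    (y % p + v % p) % p  ≡⟨ %-distribˡ-+ y v p ⟨
    (y + v) % p          ∎)
    where open ≡-Reasoning

  ≈-* : ∀ {x y u v} → x ≈ y → u ≈ v → x * u ≈ y * v
  ≈-* {x} {y} {u} {v} (≈-by-% x≈y) (≈-by-% u≈v) = ≈-by-% (begin
    (x * u) % p            ≡⟨ %-distribˡ-* x u p ⟩
    (x % p * (u % p)) % p  ≡⟨ cong₂ (λ m k → (m * k) % p) x≈y u≈v ⟩
    (y % p * (v % p)) % p  ≡⟨ %-distribˡ-* y v p ⟨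
    (y * v) % p            ∎)
    where open ≡-Reasoning

  <⇒≈⇒≡ : ∀ {x y} → x < p → y < p → x ≈ y → x ≡ y
  <⇒≈⇒≡ x<p y<p (≈-by-% x≈y) = trans (sym (m<n⇒m%n≡m x<p)) (trans x≈y (m<n⇒m%n≡m y<p))

  ∣∧<⇒≡0 : ∀ {x} → p ∣ x → x < p → x ≡ 0
  ∣∧<⇒≡0 {zero}  _   _   = refl
  ∣∧<⇒≡0 {suc x} p∣x x<p = contradiction (∣⇒≤ p∣x) (<⇒≱ x<p)

  ∣⇒+-≈ : ∀ x {d} → p ∣ d → x + d ≈ x
  ∣⇒+-≈ x p∣d = ≈-by-% (%-remove-+ʳ x p∣d)

  +-≈⇒∣ : ∀ x {d} → x + d ≈ x → p ∣ d
  +-≈⇒∣ x {d} (≈-by-% x+d≈x) = divides ((x + d) / p ∸ x / p) (begin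
    d                                                      ≡⟨ m+n∸m≡n x d ⟨
    (x + d) ∸ x                                            ≡⟨ cong₂ _∸_ (m≡m%n+[m/n]*n (x + d) p) (m≡m%n+[m/n]*n x p) ⟩
    ((x + d) % p + (x + d) / p * p) ∸ (x % p + x / p * p)  ≡⟨ cong (λ r → (r + (x + d) / p * p) ∸ (x % p + x / p * p)) x+d≈x ⟩
    (x % p + (x + d) / p * p) ∸ (x % p + x / p * p)        ≡⟨ [m+n]∸[m+o]≡n∸o (x % p) _ _ ⟩
    (x + d) / p * p ∸ x / p * p                            ≡⟨ *-distribʳ-∸ p ((x + d) / p) (x / p) ⟨
    ((x + d) / p ∸ x / p) * p                              ∎)
    where open ≡-Reasoning

  ≈0⇒∣ : ∀ {x} → x ≈ 0 → p ∣ x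
  ≈0⇒∣ {x} x≈0 = +-≈⇒∣ 0 x≈0

  residue : ℕ → Fin p
  residue x = fromℕ< (m%n<n x p)

  residue-injective : ∀ {x y} → residue x ≡ residue y → x ≈ y
  residue-injective {x} {y} e =
    ≈-by-% (trans (sym (toℕ-fromℕ< (m%n<n x p))) (trans (cong toℕ e) (toℕ-fromℕ< (m%n<n y p))))

  residue-≈ : ∀ {x} (i : Fin p) → x ≈ toℕ i → residue x ≡ i
  residue-≈ {x} i (≈-by-% x≈i) =
    toℕ-injective (trans (toℕ-fromℕ< (m%n<n x p)) (trans x≈i (m<n⇒m%n≡m (toℕ<n i))))

  -- A representative of y − x modulo p that avoids truncated subtraction.
  difference : Fin p → Fin p → ℕ
  difference x y = toℕ y + (p ∸ toℕ x)

  +-difference : ∀ x y → toℕ x + difference x y ≈ toℕ y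
  +-difference x y = ≈-by-% (begin
    (toℕ x + (toℕ y + (p ∸ toℕ x))) % p  ≡⟨ cong (_% p) (x+[y+[p∸x]]≡y+p (toℕ y) (<⇒≤ (toℕ<n x))) ⟩
    (toℕ y + p) % p                      ≡⟨ [m+n]%n≡m%n (toℕ y) p ⟩
    toℕ y % p                            ∎)
    where
    open ≡-Reasoning
    x+[y+[p∸x]]≡y+p : ∀ {x} y → x ≤ p → x + (y + (p ∸ x)) ≡ y + p
    x+[y+[p∸x]]≡y+p {x} y x≤p = begin
      x + (y + (p ∸ x))  ≡⟨ +-comm x (y + (p ∸ x)) ⟩
      y + (p ∸ x) + x    ≡⟨ +-assoc y (p ∸ x) x ⟩
      y + (p ∸ x + x)    ≡⟨ cong (y +_) (m∸n+n≡m x≤p) ⟩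
      y + p              ∎

  ∤difference : ∀ {x y} → x ≢ y → ¬ p ∣ difference x y
  ∤difference {x} {y} x≢y p∣d = x≢y (toℕ-injective (<⇒≈⇒≡ (toℕ<n x) (toℕ<n y)
    (≈-trans (≈-sym (∣⇒+-≈ (toℕ x) p∣d)) (+-difference x y))))

  module _ (prime : Prime p) where

    ∤*∤ : ∀ {m k} → ¬ p ∣ m → ¬ p ∣ k → ¬ p ∣ m * k
    ∤*∤ {m} {k} p∤m p∤k p∣mk with euclidsLemma m k prime p∣mk
    ... | inj₁ p∣m = p∤m p∣m
    ... | inj₂ p∣k = p∤k p∣k

    ∣*⇒∣ : ∀ {t m} → ¬ p ∣ t → p ∣ t * m → p ∣ m
    ∣*⇒∣ {t} {m} p∤t p∣tm with euclidsLemma t m prime p∣tm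
    ... | inj₁ p∣t = contradiction p∣t p∤t
    ... | inj₂ p∣m = p∣m

    affine-shift : ∀ {t B y d} → ¬ p ∣ t → B + t * (y + d) ≈ B + t * y → p ∣ d
    affine-shift {t} {B} {y} {d} p∤t e =
      ∣*⇒∣ p∤t (+-≈⇒∣ (B + t * y) (≈-trans (≡⇒≈ (sym (distribute B t y d))) e))
      where
      distribute : ∀ B t y d → B + t * (y + d) ≡ B + t * y + t * d
      distribute = solve-∀

    private
      affine-injective-≥ : ∀ {t B x y} → ¬ p ∣ t → y ≤ x → B + t * x ≈ B + t * y → x ≈ y
      affine-injective-≥ {t} {B} {x} {y} p∤t y≤x e =
        subst (_≈ y) (m+[n∸m]≡n y≤x)
          (∣⇒+-≈ y (affine-shift p∤t (subst (λ z → B + t * z ≈ B + t * y) (sym (m+[n∸m]≡n y≤x)) e)))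

    affine-injective : ∀ {t B x y} → ¬ p ∣ t → B + t * x ≈ B + t * y → x ≈ y
    affine-injective {x = x} {y} p∤t e with ≤-total y x
    ... | inj₁ y≤x = affine-injective-≥ p∤t y≤x e
    ... | inj₂ x≤y = ≈-sym (affine-injective-≥ p∤t x≤y (≈-sym e))

    affine-surjective : ∀ {t} → ¬ p ∣ t → ∀ B x → ∃ λ k → k < p × B + t * k ≈ x
    affine-surjective {t} p∤t B x with injective⇒surjective {f = affine} affine-injective′ (residue x)
      where
      affine : Fin p → Fin p
      affine k = residue (B + t * toℕ k)
      affine-injective′ : Injective _≡_ _≡_ affine
      affine-injective′ e =
        toℕ-injective (<⇒≈⇒≡ (toℕ<n _) (toℕ<n _) (affine-injective p∤t (residue-injective e)))
    ... | k , e = toℕ k , toℕ<n k , residue-injective e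

square : ℕ → ℕ
square x = x * x

module QuadraticResidues (h a : ℕ) (prime : Prime (suc (2 * h))) (qnr : QNR (suc (2 * h)) a) where

  p : ℕ
  p = suc (2 * h)

  open Modular p

  h<p : h < p
  h<p = s≤s (m≤m+n h (h + 0))

  ∤-positive : ∀ {x} → 0 < x → x < p → ¬ p ∣ x
  ∤-positive 0<x x<p p∣x = <⇒≢ 0<x (sym (∣∧<⇒≡0 p∣x x<p))

  ∤a : ¬ p ∣ a
  ∤a p∣a = proj₁ qnr (n∣m⇒m%n≡0 a p p∣a)

  ∤suc : ∀ {j} → j < h → ¬ p ∣ suc j
  ∤suc j<h = ∤-positive z<s (≤-<-trans j<h h<p)

  ∤square : ∀ {j} → j < h → ¬ p ∣ square (suc j)
  ∤square j<h = ∤*∤ prime (∤suc j<h) (∤suc j<h)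

  ∤-∈ : ∀ {s} → s ∈ (1 ∷ a ∷ []) → ¬ p ∣ s
  ∤-∈ (here refl)         p∣1 = ¬prime[1] (subst Prime (∣1⇒≡1 p∣1) prime)
  ∤-∈ (there (here refl))     = ∤a

  square-shift : ∀ {y d} → 0 < y → y + d ≤ h → square (y + d) ≈ square y → d ≡ 0
  square-shift {y} {d} 0<y y+d≤h e =
    [ (λ p∣d → ∣∧<⇒≡0 p∣d (≤-<-trans (≤-trans (m≤n+m d y) y+d≤h) h<p))
    , (λ p∣sum → contradiction p∣sum (∤-positive (<-≤-trans 0<y (m≤n+m y (y + d))) sum<p))
    ]′ (euclidsLemma d (y + d + y) prime (+-≈⇒∣ (square y) (≈-trans (≡⇒≈ (sym (expand y d))) e)))
    where
    expand : ∀ y d → (y + d) * (y + d) ≡ y * y + d * (y + d + y)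
    expand = solve-∀
    sum<p : y + d + y < p
    sum<p = s≤s (subst (y + d + y ≤_) (cong (h +_) (sym (+-identityʳ h)))
                  (+-mono-≤ y+d≤h (≤-trans (m≤m+n y d) y+d≤h)))

  private
    square-injective-≥ : ∀ {x y} → 0 < y → y ≤ x → x ≤ h → square x ≈ square y → x ≡ y
    square-injective-≥ {x} {y} 0<y y≤x x≤h e = begin
      x              ≡⟨ m+[n∸m]≡n y≤x ⟨
      y + (x ∸ y)    ≡⟨ cong (y +_) (square-shift 0<y (≤-trans (≤-reflexive (m+[n∸m]≡n y≤x)) x≤h) e′) ⟩
      y + 0          ≡⟨ +-identityʳ y ⟩
      y              ∎
      where
      open ≡-Reasoning
      e′ : square (y + (x ∸ y)) ≈ square y
      e′ = subst (λ z → square z ≈ square y) (sym (m+[n∸m]≡n y≤x)) e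

  square-injective : ∀ {i j : Fin h} → square (suc (toℕ i)) ≈ square (suc (toℕ j)) → i ≡ j
  square-injective {i} {j} e with ≤-total (toℕ j) (toℕ i)
  ... | inj₁ j≤i = toℕ-injective (suc-injective (square-injective-≥ z<s (s≤s j≤i) (toℕ<n i) e))
  ... | inj₂ i≤j = toℕ-injective (suc-injective (sym (square-injective-≥ z<s (s≤s i≤j) (toℕ<n j) (≈-sym e))))

  ratio-not-square : ∀ {x y} → ¬ p ∣ y → ¬ (square x ≈ a * square y)
  ratio-not-square {x} {y} p∤y e with affine-surjective prime p∤y 0 1
  ... | u , _ , yu≈1 = proj₂ qnr (x * u , %≡% xu-square≈a)
    where
    open ≈-Reasoning ≈-setoid
    regroupˡ : ∀ x u → (x * u) * (x * u) ≡ (x * x) * (u * u)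
    regroupˡ = solve-∀
    regroupʳ : ∀ a y u → a * (y * y) * (u * u) ≡ a * ((y * u) * (y * u))
    regroupʳ = solve-∀
    xu-square≈a : square (x * u) ≈ a
    xu-square≈a = begin
      square (x * u)            ≡⟨ regroupˡ x u ⟩
      square x * square u       ≈⟨ ≈-* e ≈-refl ⟩
      a * square y * square u   ≡⟨ regroupʳ a y u ⟩
      a * square (y * u)        ≈⟨ ≈-* (≈-refl {a}) (≈-* yu≈1 yu≈1) ⟩
      a * 1                     ≡⟨ *-identityʳ a ⟩
      a                         ∎

  scaledSquare : Fin 2 → Fin h → ℕ
  scaledSquare b j = square (suc (toℕ j)) * lookup (1 ∷ a ∷ []) b

  ∤scaledSquare : ∀ b j → ¬ p ∣ scaledSquare b j
  ∤scaledSquare b j = ∤*∤ prime (∤square (toℕ<n j)) (∤-∈ (∈-lookup b))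

  scaledSquare-injective : ∀ {x y : Fin 2 × Fin h} → uncurry scaledSquare x ≈ uncurry scaledSquare y → x ≡ y
  scaledSquare-injective {Fin.zero , j} {Fin.zero , j′} e =
    cong (Fin.zero ,_) (square-injective (subst₂ _≈_ (*-identityʳ _) (*-identityʳ _) e))
  scaledSquare-injective {Fin.suc Fin.zero , j} {Fin.suc Fin.zero , j′} e =
    cong (Fin.suc Fin.zero ,_)
      (square-injective (affine-injective prime {B = 0} ∤a (subst₂ _≈_ (*-comm _ a) (*-comm _ a) e)))
  scaledSquare-injective {Fin.zero , j} {Fin.suc Fin.zero , j′} e =
    contradiction (subst₂ _≈_ (*-identityʳ (square (suc (toℕ j)))) (*-comm (square (suc (toℕ j′))) a) e)
      (ratio-not-square {suc (toℕ j)} (∤suc (toℕ<n j′)))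
  scaledSquare-injective {Fin.suc Fin.zero , j} {Fin.zero , j′} e =
    contradiction (subst₂ _≈_ (*-identityʳ (square (suc (toℕ j′)))) (*-comm (square (suc (toℕ j))) a) (≈-sym e))
      (ratio-not-square {suc (toℕ j′)} (∤suc (toℕ<n j)))

  value : Fin (2 * h) → ℕ
  value i = uncurry scaledSquare (remQuot {2} h i)

  enumerate : Fin p → Fin p
  enumerate Fin.zero    = Fin.zero
  enumerate (Fin.suc i) = residue (value i)

  zero≢residue : ∀ {x} → ¬ p ∣ x → Fin.zero ≢ residue x
  zero≢residue p∤x e = p∤x (≈0⇒∣ (≈-sym (residue-injective e)))

  enumerate-injective : Injective _≡_ _≡_ enumerate
  enumerate-injective {Fin.zero}  {Fin.zero}   _ = refl
  enumerate-injective {Fin.zero}  {Fin.suc i′} e =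
    contradiction e (zero≢residue (uncurry ∤scaledSquare (remQuot {2} h i′)))
  enumerate-injective {Fin.suc i} {Fin.zero}   e =
    contradiction (sym e) (zero≢residue (uncurry ∤scaledSquare (remQuot {2} h i)))
  enumerate-injective {Fin.suc i} {Fin.suc i′} e = cong Fin.suc (begin
    i                                   ≡⟨ combine-remQuot {2} h i ⟨
    uncurry combine (remQuot {2} h i)   ≡⟨ cong (uncurry combine) same-pair ⟩
    uncurry combine (remQuot {2} h i′)  ≡⟨ combine-remQuot {2} h i′ ⟩
    i′                                  ∎)
    where
    open ≡-Reasoning
    same-pair : remQuot {2} h i ≡ remQuot {2} h i′
    same-pair = scaledSquare-injective {remQuot {2} h i} {remQuot {2} h i′} (residue-injective e)

  scaledSquare-surjective : ∀ {d} → ¬ p ∣ d → ∃₂ λ b j → scaledSquare b j ≈ d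
  scaledSquare-surjective {d} p∤d with injective⇒surjective enumerate-injective (residue d)
  ... | Fin.zero  , e = contradiction e (zero≢residue p∤d)
  ... | Fin.suc i , e = proj₁ (remQuot {2} h i) , proj₂ (remQuot {2} h i) , residue-injective e

module SquareStepColouring (h a : ℕ) (0<a : 0 < a) (prime : Prime (suc (2 * h))) (qnr : QNR (suc (2 * h)) a) where

  open QuadraticResidues h a prime qnr
  open Modular p

  J : List ℕ
  J = 1 ∷ a ∷ []

  L : ℕ
  L = 2 * h + a

  n : ℕ
  n = suc (h * L)

  0<h : 0 < h
  0<h = n≢0⇒n>0 λ { refl → ¬prime[1] prime }

  a<L : a < L
  a<L = m<n+m a (<-≤-trans 0<h (m≤m+n h (h + 0)))

  instance
    L-nonZero : NonZero L
    L-nonZero = >-nonZero (<-trans 0<a a<L)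

  ∈J⇒≤a : ∀ {s} → s ∈ J → s ≤ a
  ∈J⇒≤a (here refl)         = 0<a
  ∈J⇒≤a (there (here refl)) = ≤-refl

  base : ℕ → ℕ
  base zero    = 0
  base (suc j) = base j + square (suc j) * L

  colour : ℕ → ℕ
  colour v = base (v / L) + square (suc (v / L)) * (v % L)

  colour-block< : ∀ j {k} → k < L → colour (k + j * L) ≡ base j + square (suc j) * k
  colour-block< j {k} k<L = cong₂ (λ q r → base q + square (suc q) * r) quotient remainder
    where
    quotient : (k + j * L) / L ≡ j
    quotient = trans (+-distrib-/-∣ʳ k (n∣m*n j)) (cong₂ _+_ (m<n⇒m/n≡0 k<L) (m*n/n≡m j L))
    remainder : (k + j * L) % L ≡ k
    remainder = trans ([m+kn]%n≡m%n k j L) (m<n⇒m%n≡m k<L)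

  colour-block : ∀ j {k} → k ≤ L → colour (k + j * L) ≡ base j + square (suc j) * k
  colour-block j k≤L with m≤n⇒m<n∨m≡n k≤L
  ... | inj₁ k<L  = colour-block< j k<L
  ... | inj₂ refl = begin
    colour (0 + suc j * L)                   ≡⟨ colour-block< (suc j) (<-trans 0<a a<L) ⟩
    base (suc j) + square (suc (suc j)) * 0  ≡⟨ cong (base (suc j) +_) (*-zeroʳ (square (suc (suc j)))) ⟩
    base (suc j) + 0                         ≡⟨ +-identityʳ (base (suc j)) ⟩
    base j + square (suc j) * L              ∎
    where open ≡-Reasoning

  block-vertex<n : ∀ {j k} → j < h → k ≤ L → k + j * L < n
  block-vertex<n {j} {k} j<h k≤L = s≤s (begin
    k + j * L  ≤⟨ +-monoˡ-≤ (j * L) k≤L ⟩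
    suc j * L  ≤⟨ *-monoˡ-≤ L j<h ⟩
    h * L      ∎)
    where open ≤-Reasoning

  -- The position of v in the block (jL, jL + L] containing it (vertex 0 has position 0).
  -- With these half-open blocks the last vertex hL has position L, so that an arc wrapping
  -- around n also lowers the position.
  potential : ℕ → ℕ
  potential zero    = 0
  potential (suc v) = suc (v % L)

  block : ℕ → ℕ
  block zero    = 0
  block (suc v) = v / L

  block-decomposition : ∀ v → v ≡ potential v + block v * L
  block-decomposition zero    = refl
  block-decomposition (suc v) = cong suc (m≡m%n+[m/n]*n v L)

  potential≤L : ∀ v → potential v ≤ L
  potential≤L zero    = z≤n
  potential≤L (suc v) = m%n<n v L

  potential≤ : ∀ v → potential v ≤ v
  potential≤ zero    = z≤n
  potential≤ (suc v) = s≤s (m%n≤m v L)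

  block<h : ∀ {v} → v < n → block v < h
  block<h {zero}  _   = 0<h
  block<h {suc v} v<n = m<n*o⇒m/o<n (s≤s⁻¹ v<n)

  potential-block : ∀ m {r} → 0 < r → r ≤ L → potential (r + m * L) ≡ r
  potential-block m {suc r} _ r<L = cong suc (trans ([m+kn]%n≡m%n r m L) (m<n⇒m%n≡m r<L))

  regroup : ∀ k x s → k + x + s ≡ (k + s) + x
  regroup = solve-∀

  within-block : ∀ {j k s} → j < h → s ∈ J → k + s ≤ L → ¬ colour (k + j * L) ≈ colour (k + j * L + s)
  within-block {j} {k} {s} j<h s∈J k+s≤L monochromatic =
    ∤-∈ s∈J (affine-shift prime {B = base j} {y = k} (∤square j<h) (≈-sym (begin
      base j + square (suc j) * k        ≡⟨ colour-block j (≤-trans (m≤m+n k s) k+s≤L) ⟨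
      colour (k + j * L)                 ≈⟨ monochromatic ⟩
      colour (k + j * L + s)             ≡⟨ cong colour (regroup k (j * L) s) ⟩
      colour ((k + s) + j * L)           ≡⟨ colour-block j k+s≤L ⟩
      base j + square (suc j) * (k + s)  ∎)))
    where open ≈-Reasoning ≈-setoid

  across-blocks : ∀ {j k s} → k ≤ L → s ∈ J → L < k + s → potential (k + j * L + s) < k
  across-blocks {j} {k} {s} k≤L s∈J L<k+s = begin-strict
    potential (k + j * L + s)           ≡⟨ cong potential shifted ⟩
    potential (r + suc j * L)           ≡⟨ potential-block (suc j) (m<n⇒0<n∸m L<k+s) (≤-trans (<⇒≤ r<k) k≤L) ⟩
    r                                   <⟨ r<k ⟩
    k                                   ∎
    where
    open ≤-Reasoning
    r : ℕ
    r = k + s ∸ L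
    r<k : r < k
    r<k = subst (r <_) (m+n∸n≡m k L) (∸-monoˡ-< (+-monoʳ-< k (≤-<-trans (∈J⇒≤a s∈J) a<L)) (<⇒≤ L<k+s))
    shifted : k + j * L + s ≡ r + suc j * L
    shifted = begin-equality
      k + j * L + s    ≡⟨ regroup k (j * L) s ⟩
      (k + s) + j * L  ≡⟨ cong (_+ j * L) (m∸n+n≡m (<⇒≤ L<k+s)) ⟨
      (r + L) + j * L  ≡⟨ +-assoc r L (j * L) ⟩
      r + suc j * L    ∎

  L<n : L < n
  L<n = subst (_< n) (+-identityʳ L) (block-vertex<n 0<h ≤-refl)

  wrap-around : ∀ {j k s} → j < h → k ≤ L → s ∈ J → n ≤ k + j * L + s → potential ((k + j * L + s) % n) < k
  wrap-around {j} {k} {s} j<h k≤L s∈J n≤u+s = begin-strict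
    potential ((u + s) % n)  ≡⟨ cong potential wrapped ⟩
    potential (u + s ∸ n)    ≤⟨ potential≤ (u + s ∸ n) ⟩
    u + s ∸ n                <⟨ w<k ⟩
    k                        ∎
    where
    open ≤-Reasoning
    u : ℕ
    u = k + j * L
    u+s<k+n : u + s < k + n
    u+s<k+n = subst (_< k + n) (sym (+-assoc k (j * L) s))
      (+-monoʳ-< k (subst (_< n) (+-comm s (j * L)) (block-vertex<n j<h (≤-trans (∈J⇒≤a s∈J) (<⇒≤ a<L)))))
    w<k : u + s ∸ n < k
    w<k = subst (u + s ∸ n <_) (m+n∸n≡m k n) (∸-monoˡ-< u+s<k+n n≤u+s)
    wrapped : (u + s) % n ≡ u + s ∸ n
    wrapped = trans (sym (m≤n⇒[n∸m]%m≡n%m n≤u+s)) (m<n⇒m%n≡m (<-≤-trans w<k (≤-trans k≤L (<⇒≤ L<n))))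

  arc-descends : ∀ {j k s} → j < h → k ≤ L → s ∈ J →
    colour (k + j * L) ≈ colour ((k + j * L + s) % n) → potential ((k + j * L + s) % n) < k
  arc-descends {j} {k} {s} j<h k≤L s∈J monochromatic with k + j * L + s <? n
  ... | no  u+s≮n = wrap-around j<h k≤L s∈J (≮⇒≥ u+s≮n)
  ... | yes u+s<n with k + s ≤? L
  ...   | yes k+s≤L = contradiction (≈-trans monochromatic (≡⇒≈ (cong colour (m<n⇒m%n≡m u+s<n))))
                                    (within-block j<h s∈J k+s≤L)
  ...   | no  k+s≰L = subst (λ w → potential w < k) (sym (m<n⇒m%n≡m u+s<n))
                            (across-blocks {j} k≤L s∈J (≰⇒> k+s≰L))

  monochromatic-arc-descends : ∀ {u s} → u < n → s ∈ J → colour u ≈ colour ((u + s) % n) →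
    potential ((u + s) % n) < potential u
  monochromatic-arc-descends {u} {s} u<n s∈J monochromatic =
    subst (λ v → potential ((v + s) % n) < potential u) (sym (block-decomposition u))
      (arc-descends (block<h u<n) (potential≤L u) s∈J
        (subst (λ v → colour v ≈ colour ((v + s) % n)) (block-decomposition u) monochromatic))

  D : Digraph
  D = Circulant n J

  c : Coloring D p
  c v = residue (colour (toℕ v))

  c-acyclic : Acyclic D c
  c-acyclic = acyclic-by-potential D c (potential ∘ toℕ) λ u w (s , s∈J , u+s≡w) cu≡cw →
    subst (λ v → potential v < potential (toℕ u)) u+s≡w
      (monochromatic-arc-descends (toℕ<n u) s∈J
        (subst (λ v → colour (toℕ u) ≈ colour v) (sym u+s≡w) (residue-injective cu≡cw)))

  block-vertex : ∀ {j k} → j < h → k ≤ L → Fin n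
  block-vertex j<h k≤L = fromℕ< (block-vertex<n j<h k≤L)

  c-block-vertex : ∀ {j k} (j<h : j < h) (k≤L : k ≤ L) →
    c (block-vertex j<h k≤L) ≡ residue (base j + square (suc j) * k)
  c-block-vertex {j} j<h k≤L =
    cong residue (trans (cong colour (toℕ-fromℕ< (block-vertex<n j<h k≤L))) (colour-block j k≤L))

  c-surjective : Surjective _≡_ _≡_ c
  c-surjective y =
    block-vertex 0<h y≤L , λ { refl → trans (c-block-vertex 0<h y≤L) (residue-≈ y (≡⇒≈ (*-identityˡ (toℕ y)))) }
    where
    y≤L : toℕ y ≤ L
    y≤L = ≤-trans (<⇒≤ (toℕ<n y)) (≤-trans (≤-reflexive (+-comm 1 (2 * h))) (+-monoʳ-≤ (2 * h) 0<a))

  c-complete : ∀ x y → x ≢ y → Σ (Fin n) λ u → Σ (Fin n) λ w → Arc D u w × c u ≡ x × c w ≡ y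
  c-complete x y x≢y with scaledSquare-surjective (∤difference x≢y)
  ... | b , j′ , step≈d with affine-surjective prime (∤square (toℕ<n j′)) (base (toℕ j′)) (toℕ x)
  ... | k , k<p , start≈x =
    block-vertex j<h k≤L , block-vertex j<h k+s≤L , (s , ∈-lookup b , arc) ,
    trans (c-block-vertex j<h k≤L) (residue-≈ x start≈x) ,
    trans (c-block-vertex j<h k+s≤L) (residue-≈ y end≈y)
    where
    j : ℕ
    j = toℕ j′
    j<h : j < h
    j<h = toℕ<n j′
    s : ℕ
    s = lookup J b
    k+s≤L : k + s ≤ L
    k+s≤L = +-mono-≤ (s≤s⁻¹ k<p) (∈J⇒≤a (∈-lookup b))
    k≤L : k ≤ L
    k≤L = ≤-trans (m≤m+n k s) k+s≤L
    arc : (toℕ (block-vertex j<h k≤L) + s) % n ≡ toℕ (block-vertex j<h k+s≤L)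
    arc = begin
      (toℕ (block-vertex j<h k≤L) + s) % n  ≡⟨ cong (λ v → (v + s) % n) (toℕ-fromℕ< (block-vertex<n j<h k≤L)) ⟩
      (k + j * L + s) % n                   ≡⟨ cong (_% n) (regroup k (j * L) s) ⟩
      ((k + s) + j * L) % n                 ≡⟨ m<n⇒m%n≡m (block-vertex<n j<h k+s≤L) ⟩
      (k + s) + j * L                       ≡⟨ toℕ-fromℕ< (block-vertex<n j<h k+s≤L) ⟨
      toℕ (block-vertex j<h k+s≤L)          ∎
      where open ≡-Reasoning
    end≈y : base j + square (suc j) * (k + s) ≈ toℕ y
    end≈y = begin
      base j + square (suc j) * (k + s)                    ≡⟨ distribute (base j) (square (suc j)) k s ⟩
      (base j + square (suc j) * k) + square (suc j) * s   ≈⟨ ≈-+ start≈x step≈d ⟩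
      toℕ x + difference x y                               ≈⟨ +-difference x y ⟩
      toℕ y                                                ∎
      where
      open ≈-Reasoning ≈-setoid
      distribute : ∀ B t k s → B + t * (k + s) ≡ (B + t * k) + t * s
      distribute = solve-∀

  complete-acyclic-colouring : HasCompleteAcyclic D p
  complete-acyclic-colouring = c , (c-surjective , c-complete) , c-acyclic

module ColourClasses {n k : ℕ} (c : Fin n → Fin k) where

  colourClass : Fin k → List (Fin n)
  colourClass i = filter (λ v → c v Fin.≟ i) (allFin n)

  ∈-colourClass⁺ : ∀ {v i} → c v ≡ i → v ∈ colourClass i
  ∈-colourClass⁺ {v} {i} cv≡i = ∈-filter⁺ (λ v → c v Fin.≟ i) (∈-allFin v) cv≡i

  ∈-colourClass⁻ : ∀ {v i} → v ∈ colourClass i → c v ≡ i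
  ∈-colourClass⁻ {v} {i} = proj₂ ∘ ∈-filter⁻ (λ v → c v Fin.≟ i) {xs = allFin n}

  colourClass-unique : ∀ i → Unique (colourClass i)
  colourClass-unique i = filter⁺ (λ v → c v Fin.≟ i) (allFin⁺ n)

  large-colourClasses⇒≤ : ∀ {m} → (∀ i → m ≤ length (colourClass i)) → k * m ≤ n
  large-colourClasses⇒≤ {m} large = injective⇒≤ {f = pick ∘ remQuot m} (λ e → remQuot-injective (pick-injective e))
    where
    pick : Fin k × Fin m → Fin n
    pick (i , r) = lookup (colourClass i) (inject≤ r (large i))
    pick-injective : Injective _≡_ _≡_ pick
    pick-injective {i , r} {i′ , r′} e
      with refl ← trans (sym (∈-colourClass⁻ (∈-lookup _))) (trans (cong c e) (∈-colourClass⁻ (∈-lookup _)))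
      = cong (i ,_) (inject≤-injective _ _ r r′ (lookup-injective (colourClass-unique i) e))
    remQuot-injective : Injective _≡_ _≡_ (remQuot {k} m)
    remQuot-injective {x} {y} e =
      trans (sym (combine-remQuot {k} m x)) (trans (cong (uncurry combine) e) (combine-remQuot {k} m y))

module _ {n k : ℕ} .{{_ : NonZero n}} {J : List ℕ} (c : Coloring (Circulant n J) (suc k)) where

  open ColourClasses c

  -- Each colour other than i is the colour of the head of an arc leaving class i,
  -- and an arc is determined by its tail and its jump.
  complete⇒colourClass-size : Complete (Circulant n J) c → ∀ i → k ≤ length (colourClass i) * length J
  complete⇒colourClass-size (_ , complete) i =
    injective⇒≤ {f = encode ∘ witness} λ e → punchIn-injective i _ _ (encode-injective (witness _) (witness _) e)
    where
    Witness : Fin (suc k) → Set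
    Witness j = Σ (Fin n) λ u → Σ (Fin n) λ v → Arc (Circulant n J) u v × c u ≡ i × c v ≡ j
    witness : (j : Fin k) → Witness (punchIn i j)
    witness j = complete i (punchIn i j) (punchInᵢ≢i i j ∘ sym)
    encode : ∀ {j} → Witness j → Fin (length (colourClass i) * length J)
    encode (_ , _ , (_ , s∈J , _) , cu≡i , _) = combine (index (∈-colourClass⁺ cu≡i)) (index s∈J)
    encode-injective : ∀ {j j′} (w : Witness j) (w′ : Witness j′) → encode w ≡ encode w′ → j ≡ j′
    encode-injective (u , v , (s , s∈J , u+s≡v) , cu≡i , cv≡j)
                     (u′ , v′ , (s′ , s′∈J , u′+s′≡v′) , cu′≡i , cv′≡j′) e
      with same-index , same-jump ← combine-injective (index (∈-colourClass⁺ cu≡i)) (index s∈J)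
                                                      (index (∈-colourClass⁺ cu′≡i)) (index s′∈J) e
      with refl ← index-injective (setoid (Fin n)) (∈-colourClass⁺ cu≡i) (∈-colourClass⁺ cu′≡i) same-index
         | refl ← index-injective (setoid ℕ) s∈J s′∈J same-jump
      = trans (sym cv≡j) (trans (cong c (toℕ-injective (trans (sym u+s≡v) u′+s′≡v′))) cv′≡j′)

  complete⇒size-bound : ∀ {m} → Complete (Circulant n J) c → m * length J < k → suc k * suc m ≤ n
  complete⇒size-bound {m} complete m*|J|<k = large-colourClasses⇒≤ λ i →
    *-cancelʳ-< (length J) m (length (colourClass i)) (<-≤-trans m*|J|<k (complete⇒colourClass-size complete i))

complete-colouring-bound : ∀ q {s₁ s₂ k} (c : Coloring (Circulant (6 + 14 * q + 8 * q * q) (s₁ ∷ s₂ ∷ [])) k) →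
  3 + 4 * q < k → ¬ Complete (Circulant (6 + 14 * q + 8 * q * q) (s₁ ∷ s₂ ∷ [])) c
complete-colouring-bound q {k = suc k} c (s≤s 3+4q≤k) complete = <-irrefl refl (begin-strict
  6 + 14 * q + 8 * q * q                 <⟨ m<m+n _ z<s ⟩
  6 + 14 * q + 8 * q * q + (2 + 2 * q)   ≡⟨ expand q ⟨
  (4 + 4 * q) * (2 + 2 * q)              ≤⟨ *-monoˡ-≤ (2 + 2 * q) (s≤s 3+4q≤k) ⟩
  suc k * (2 + 2 * q)                    ≤⟨ complete⇒size-bound c complete [1+2q]*2<k ⟩
  6 + 14 * q + 8 * q * q                 ∎)
  where
  open ≤-Reasoning
  expand : ∀ q → (4 + 4 * q) * (2 + 2 * q) ≡ 6 + 14 * q + 8 * q * q + (2 + 2 * q)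
  expand = solve-∀
  double : ∀ q → (1 + 2 * q) * 2 ≡ 2 + 4 * q
  double = solve-∀
  [1+2q]*2<k : (1 + 2 * q) * 2 < k
  [1+2q]*2<k = subst (_≤ k) (cong suc (sym (double q))) 3+4q≤k

theorem5 : (q : ℕ) → Prime (3 + 4 * q) →
    ((a : ℕ) → 0 < a → QNR (3 + 4 * q) a →
      DacGe (Circulant (3 + a + 2 * (a + 4) * q + 8 * q * q) (1 ∷ a ∷ [])) (3 + 4 * q))
    × (QNR (3 + 4 * q) 3 →
      DacEq (Circulant (6 + 14 * q + 8 * q * q) (1 ∷ 3 ∷ [])) (3 + 4 * q))
theorem5 q p-prime =
  (λ a 0<a qnr → 3 + 4 * q , ≤-refl , colouring a 0<a qnr) ,
  (λ qnr₃ → colouring 3 z<s qnr₃ , λ k 3+4q<k (c , complete , _) → complete-colouring-bound q c 3+4q<k complete)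
  where
  h : ℕ
  h = 1 + 2 * q
  2h≡ : 2 + 4 * q ≡ 2 * h
  2h≡ = double q
    where
    double : ∀ q → 2 + 4 * q ≡ 2 * (1 + 2 * q)
    double = solve-∀
  vertices≡ : ∀ a → h * (2 * h + a) ≡ 2 + a + 2 * (a + 4) * q + 8 * q * q
  vertices≡ = expand q
    where
    expand : ∀ q a → (1 + 2 * q) * (2 * (1 + 2 * q) + a) ≡ 2 + a + 2 * (a + 4) * q + 8 * q * q
    expand = solve-∀
  colouring : ∀ a → 0 < a → QNR (3 + 4 * q) a →
    HasCompleteAcyclic (Circulant (3 + a + 2 * (a + 4) * q + 8 * q * q) (1 ∷ a ∷ [])) (3 + 4 * q)
  colouring a 0<a qnr =
    subst₂ (λ m k → HasCompleteAcyclic (Circulant (suc m) (1 ∷ a ∷ [])) (suc k)) (vertices≡ a) (sym 2h≡)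
      (SquareStepColouring.complete-acyclic-colouring h a 0<a
        (subst (λ m → Prime (suc m)) 2h≡ p-prime) (subst (λ m → QNR (suc m) a) 2h≡ qnr))
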